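{- Let $k \geq 3$ and let $\mathcal{H}$ be a hypergraph such that $\delta(\mathcal{H}) \geq 2^{k-2}+2$. Then $\mathcal{H}$ contains a Berge cycle of length at least $k$.
   Context: A hypergraph $\mathcal{H}$ is a finite vertex set $V(\mathcal{H})$ together with a set $E(\mathcal{H})$ of subsets of $V(\mathcal{H})$ (the hyperedges), with no restriction on their sizes. Hypergraphs are simple: no hyperedge is repeated. The degree of a vertex is the number of hyperedges containing it, and $\delta(\mathcal{H})$ is the minimum degree. A Berge cycle of length $\ell$ consists of $\ell$ distinct vertices $v_1, \ldots, v_\ell$ and $\ell$ distinct hyperedges $e_1, \ldots, e_\ell$ such that $\{v_i, v_{i+1}\} \subseteq e_i$ for all $i$, with indices taken modulo $\ell$. -}

module Defs where

open import Data.Nat using (ℕ; suc; _+_; _≤_; _^_; _∸_; NonZero)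
open import Data.Fin using (Fin; toℕ; fromℕ<)
open import Data.Fin.Subset using (Subset; _∈_)
open import Data.Nat.DivMod using (_%_; m%n<n)
open import Data.List using (List; filter; length; allFin)
open import Data.Product using (Σ; _×_; ∃; ∃-syntax)
open import Function.Definitions using (Injective)
open import Relation.Binary.PropositionalEquality using (_≡_)
open import Data.Fin.Subset.Properties using () renaming (_∈?_ to _∈ₛ?_)

-- A (simple) hypergraph on vertex set Fin n with m hyperedges,
-- given as an injective family of subsets of the vertex set
-- (injectivity = no hyperedge is repeated).
record Hypergraph : Set where
  field
    n     : ℕ
    m     : ℕ
    edge  : Fin m → Subset n
    simple : Injective _≡_ _≡_ edge

open Hypergraph public

degree : (H : Hypergraph) → Fin (n H) → ℕ
degree H v = length (filter (λ i → v ∈ₛ? edge H i) (allFin (m H)))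

MinDegreeAtLeast : Hypergraph → ℕ → Set
MinDegreeAtLeast H d = (v : Fin (n H)) → d ≤ degree H v

next : {ℓ : ℕ} → Fin (suc ℓ) → Fin (suc ℓ)
next {ℓ} i = fromℕ< (m%n<n (suc (toℕ i)) (suc ℓ))

record BergeCycle (H : Hypergraph) (ℓ : ℕ) : Set where
  field
    vs     : Fin (suc ℓ) → Fin (n H)
    es     : Fin (suc ℓ) → Fin (m H)
    vs-inj : Injective _≡_ _≡_ vs
    es-inj : Injective _≡_ _≡_ es
    here   : (i : Fin (suc ℓ)) → vs i ∈ edge H (es i)
    there  : (i : Fin (suc ℓ)) → vs (next i) ∈ edge H (es i)

HasBergeCycleOfLengthAtLeast : Hypergraph → ℕ → Set
HasBergeCycleOfLengthAtLeast H k = ∃[ ℓ ] (k ≤ suc ℓ × BergeCycle H ℓ)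

-- Write k = r + 3 and grow a Berge path x e₁ v₁ … e_t v_t at its free end x; let S = {x, v₁, …, v_{k−2}}.
-- An edge through x lying inside {x} ∪ T is determined by its trace on T, so if x lies in more than
-- |Z| + 2 ^ |T| edges, some edge through x avoids Z and contains a vertex u ∉ {x} ∪ T. Such an edge
-- extends the path (u new) or closes a cycle of length ≥ k: through u = v_j with j ≥ k − 1 if it is off
-- the path, or through v_{j−1} if it is a path edge e_j with j ≥ k.
-- If no e_j with j ≤ k − 2 leaves S, take T = S ∖ {x} and Z = {e_{k−1}}: 1 + 2 ^ (k − 2) < δ.
-- Otherwise some such g = e_j leaves S; take T = S ∖ {x, v_j} and Z = {e₁, …, e_{k−1}}, which fits since
-- k − 3 < 2 ^ (k − 3). The one new case u = v_j is a Pósa rotation: v_{j−1} e_{j−1} … e₁ x i v_j e_{j+1} …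
-- is a path of the same length with the same first k − 1 vertices, on which g is unused, contains the
-- free end v_{j−1} and leaves S, so g extends or closes it.
-- Every round yields a long cycle or a longer path, and paths have fewer than |V| edges.
module Submission where

open import Defs
open import Data.Bool using (Bool; true; false)
open import Data.Fin as Fin using (Fin; toℕ; fromℕ<)
open import Data.Fin.Properties as Fin using (toℕ-injective; toℕ<n; toℕ≤pred[n]; toℕ-fromℕ<)
open import Data.Fin.Subset using () renaming (_∈_ to _∈ₛ_; _⊆_ to _⊆ₛ_)
open import Data.Fin.Subset.Properties using (⊆-antisym) renaming (_∈?_ to _∈ₛ?_)
open import Data.List using (List; []; _∷_; _++_; [_]; map; length; take; drop; reverse; filter; allFin)
open import Data.List.Properties
  using (∷-injectiveʳ; ++-assoc; map-++; take-map; filter-notAll; unfold-reverse;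
         length-map; length-++; length-take; length-reverse; length-tabulate)
open import Data.List.Membership.Propositional using (_∈_; _∉_; find)
open import Data.List.Membership.Propositional.Properties
  using (∈-++⁺ˡ; ∈-++⁺ʳ; ∈-∃++; ∈-map⁺; ∈-map⁻; ∈-filter⁺; ∈-filter⁻; ∈-allFin)
open import Data.List.Relation.Binary.Subset.Propositional using (_⊆_)
open import Data.List.Relation.Binary.Permutation.Propositional using (_↭_; ↭-sym; ↭-trans; ↭⇒↭ₛ)
open import Data.List.Relation.Binary.Permutation.Propositional.Properties
  using (∈-resp-↭; shift; ++⁺ʳ; ↭-reverse; ↭-length; ∷↭∷ʳ)
import Data.List.Relation.Binary.Permutation.Setoid.Properties as Permutationₛ
open import Data.List.Relation.Unary.All as All using ([]; _∷_)
import Data.List.Relation.Unary.All.Properties as All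
open import Data.List.Relation.Unary.AllPairs using ([]; _∷_)
open import Data.List.Relation.Unary.Any as Any using (Any; here; there)
import Data.List.Relation.Unary.Any.Properties as Any
open import Data.List.Relation.Unary.Unique.Propositional using (Unique)
open import Data.List.Relation.Unary.Unique.Propositional.Properties
  using (Unique[x∷xs]⇒x∉xs; filter⁺; allFin⁺)
open import Data.Nat using (ℕ; zero; suc; _≤_; _<_; _+_; _^_; _∸_; z≤n; s≤s)
open import Data.Nat.DivMod using (_%_; m<n⇒m%n≡m; n%n≡0)
open import Data.Nat.Properties
open import Data.Nat.Tactic.RingSolver using (solve-∀)
open import Data.Product using (_×_; _,_; proj₁; proj₂; ∃; ∃₂)
open import Data.Sum as Sum using (_⊎_; inj₁; inj₂)
open import Data.Sum.Properties using (inj₂-injective)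
open import Data.Unit using (⊤; tt)
open import Function using (_∘_)
open import Function.Definitions using (Injective)
open import Relation.Binary.PropositionalEquality
  using (_≡_; refl; sym; trans; cong; cong₂; subst; subst₂; setoid; module ≡-Reasoning)
open import Relation.Nullary using (¬_; contradiction; Dec; yes; no; does; ¬?)
open import Relation.Nullary.Decidable using (_×-dec_; decidable-stable)

private
  variable
    A B : Set

Unique-resp-↭ : {xs ys : List A} → xs ↭ ys → Unique xs → Unique ys
Unique-resp-↭ p = Permutationₛ.Unique-resp-↭ (setoid _) (↭⇒↭ₛ p)

Unique-∷ : ∀ {x : A} {xs} → x ∉ xs → Unique xs → Unique (x ∷ xs)
Unique-∷ x∉xs xs! = All.¬Any⇒All¬ _ x∉xs ∷ xs!

Unique-++⁻ˡ : ∀ (xs : List A) {ys} → Unique (xs ++ ys) → Unique xs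
Unique-++⁻ˡ [] _ = []
Unique-++⁻ˡ (x ∷ xs) (x≢ ∷ xs!) = All.++⁻ˡ xs x≢ ∷ Unique-++⁻ˡ xs xs!

Unique-map⁺ : ∀ {f : A → B} {xs} →
  (∀ {x y} → x ∈ xs → y ∈ xs → f x ≡ f y → x ≡ y) → Unique xs → Unique (map f xs)
Unique-map⁺ _ [] = []
Unique-map⁺ {f = f} {xs = x ∷ xs} inj (x≢xs ∷ xs!) =
  Unique-∷ fx∉ (Unique-map⁺ (λ p q → inj (there p) (there q)) xs!)
  where
  fx∉ : f x ∉ map f xs
  fx∉ fx∈ with ∈-map⁻ f fx∈
  ... | y , y∈xs , fx≡fy = All.lookup x≢xs y∈xs (inj (here refl) (there y∈xs) fx≡fy)

Unique⇒length≤ : ∀ {xs ys : List A} → Unique xs → xs ⊆ ys → length xs ≤ length ys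
Unique⇒length≤ [] _ = z≤n
Unique⇒length≤ {xs = x ∷ xs} (x∉xs ∷ xs!) xs⊆ys with ∈-∃++ (xs⊆ys (here refl))
... | ys₁ , ys₂ , refl = begin
  suc (length xs)           ≤⟨ s≤s (Unique⇒length≤ xs! xs⊆ys₁++ys₂) ⟩
  suc (length (ys₁ ++ ys₂)) ≡⟨ ↭-length (shift x ys₁ ys₂) ⟨
  length (ys₁ ++ x ∷ ys₂)   ∎
  where
  open ≤-Reasoning
  xs⊆ys₁++ys₂ : xs ⊆ ys₁ ++ ys₂
  xs⊆ys₁++ys₂ z∈xs with ∈-resp-↭ (shift x ys₁ ys₂) (xs⊆ys (there z∈xs))
  ... | here z≡x = contradiction (sym z≡x) (All.lookup x∉xs z∈xs)
  ... | there z∈ = z∈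

∉-middle : ∀ xs {ys : List A} {x} → Unique (xs ++ x ∷ ys) → x ∉ xs ++ ys
∉-middle xs {ys} {x} xs++x∷ys! = Unique[x∷xs]⇒x∉xs (Unique-resp-↭ (shift x xs ys) xs++x∷ys!)

exchange : ∀ xs {ys : List A} {g i} → Unique (xs ++ g ∷ ys) → i ∉ xs ++ g ∷ ys →
  Unique (reverse xs ++ i ∷ ys) × g ∉ reverse xs ++ i ∷ ys
exchange xs {ys} {g} {i} old! i∉old = Unique-resp-↭ (↭-sym new↭) (Unique-∷ i∉rest rest!) , g∉new
  where
  new↭ : reverse xs ++ i ∷ ys ↭ i ∷ xs ++ ys
  new↭ = ↭-trans (++⁺ʳ (i ∷ ys) (↭-reverse xs)) (shift i xs ys)
  rest! : Unique (xs ++ ys)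
  rest! with Unique-resp-↭ (shift g xs ys) old!
  ... | _ ∷ rest! = rest!
  i∉rest : i ∉ xs ++ ys
  i∉rest = i∉old ∘ ∈-resp-↭ (↭-sym (shift g xs ys)) ∘ there
  g∉new : g ∉ reverse xs ++ i ∷ ys
  g∉new g∈new with ∈-resp-↭ new↭ g∈new
  ... | here refl = i∉old (∈-++⁺ʳ xs (here refl))
  ... | there g∈rest = ∉-middle xs old! g∈rest

∈-map-split : ∀ (f : A → B) {y} xs → y ∈ map f xs →
  ∃ λ pre → ∃ λ a → ∃ λ post → xs ≡ pre ++ a ∷ post × y ≡ f a
∈-map-split f xs y∈ with ∈-map⁻ f y∈
... | a , a∈xs , y≡fa with ∈-∃++ a∈xs
...   | pre , post , xs≡ = pre , a , post , xs≡ , y≡fa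

∈-take-split : ∀ n (xs : List A) {x} → x ∈ take n xs →
  ∃ λ pre → ∃ λ post → xs ≡ pre ++ x ∷ post × length pre < n
∈-take-split (suc n) (y ∷ xs) (here refl) = [] , xs , refl , s≤s z≤n
∈-take-split (suc n) (y ∷ xs) (there x∈) with ∈-take-split n xs x∈
... | pre , post , refl , lt = y ∷ pre , post , refl , s≤s lt

∈-take-map : ∀ (f : A → B) n xs {x ys} → length xs < n → f x ∈ take n (map f (xs ++ x ∷ ys))
∈-take-map f (suc n) [] _ = here refl
∈-take-map f (suc n) (y ∷ xs) (s≤s xs<n) = there (∈-take-map f n xs xs<n)

∉-take-map⇒≤ : ∀ (f : A → B) n xs {x ys} → f x ∉ take n (map f (xs ++ x ∷ ys)) → n ≤ length xs
∉-take-map⇒≤ f n xs fx∉ = ≮⇒≥ (fx∉ ∘ ∈-take-map f n xs)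

∈-take-suc : ∀ n (xs : List A) {x} → x ∈ take (suc n) xs → x ∈ take n xs ⊎ x ∈ take 1 (drop n xs)
∈-take-suc zero (y ∷ xs) x∈ = inj₂ x∈
∈-take-suc (suc n) (y ∷ xs) (here x≡y) = inj₁ (here x≡y)
∈-take-suc (suc n) (y ∷ xs) (there x∈) = Sum.map₁ there (∈-take-suc n xs x∈)

take-++-≤ : ∀ n (xs : List A) {ys} → length xs ≤ n → take n (xs ++ ys) ≡ xs ++ take (n ∸ length xs) ys
take-++-≤ n [] _ = refl
take-++-≤ (suc n) (x ∷ xs) (s≤s le) = cong (x ∷_) (take-++-≤ n xs le)

take-reverse-++ : ∀ n (xs : List A) {ys} → length xs ≤ n → take n (reverse xs ++ ys) ↭ take n (xs ++ ys)
take-reverse-++ n xs {ys} le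
  rewrite take-++-≤ n (reverse xs) {ys} (subst (_≤ n) (sym (length-reverse xs)) le)
        | take-++-≤ n xs {ys} le
        | length-reverse xs
  = ++⁺ʳ _ (↭-reverse xs)

length-take≤ : ∀ n (xs : List A) → length (take n xs) ≤ n
length-take≤ n xs = subst (_≤ n) (sym (length-take n xs)) (m⊓n≤m n (length xs))

lookupOr : A → List A → ℕ → A
lookupOr d [] _ = d
lookupOr d (x ∷ xs) zero = x
lookupOr d (x ∷ xs) (suc i) = lookupOr d xs i

lookupOr-∈ : ∀ d (xs : List A) {i} → i < length xs → lookupOr d xs i ∈ xs
lookupOr-∈ d (x ∷ xs) {zero} _ = here refl
lookupOr-∈ d (x ∷ xs) {suc i} (s≤s i<) = there (lookupOr-∈ d xs i<)

lookupOr-injective : ∀ d {xs : List A} {i j} → Unique xs → i < length xs → j < length xs →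
  lookupOr d xs i ≡ lookupOr d xs j → i ≡ j
lookupOr-injective d {i = zero} {zero} _ _ _ _ = refl
lookupOr-injective d {x ∷ xs} {zero} {suc j} (x≢xs ∷ _) _ (s≤s j<) eq =
  contradiction eq (All.lookup x≢xs (lookupOr-∈ d xs j<))
lookupOr-injective d {x ∷ xs} {suc i} {zero} (x≢xs ∷ _) (s≤s i<) _ eq =
  contradiction (sym eq) (All.lookup x≢xs (lookupOr-∈ d xs i<))
lookupOr-injective d {x ∷ xs} {suc i} {suc j} (_ ∷ xs!) (s≤s i<) (s≤s j<) eq =
  cong suc (lookupOr-injective d xs! i< j< eq)

lookupOr-∷ʳ : ∀ d (xs : List A) i → lookupOr d (xs ++ [ d ]) i ≡ lookupOr d xs i
lookupOr-∷ʳ d [] zero = refl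
lookupOr-∷ʳ d [] (suc i) = refl
lookupOr-∷ʳ d (x ∷ xs) zero = refl
lookupOr-∷ʳ d (x ∷ xs) (suc i) = lookupOr-∷ʳ d xs i

lookupOr-length : ∀ d (xs : List A) → lookupOr d xs (length xs) ≡ d
lookupOr-length d [] = refl
lookupOr-length d (x ∷ xs) = lookupOr-length d xs

toℕ-next-< : ∀ {ℓ} (i : Fin (suc ℓ)) → toℕ i < ℓ → toℕ (next i) ≡ suc (toℕ i)
toℕ-next-< {ℓ} i i<ℓ = trans (toℕ-fromℕ< _) (m<n⇒m%n≡m (s≤s i<ℓ))

toℕ-next-last : ∀ {ℓ} (i : Fin (suc ℓ)) → toℕ i ≡ ℓ → toℕ (next i) ≡ 0
toℕ-next-last {ℓ} i i≡ℓ = begin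
  toℕ (next i)         ≡⟨ toℕ-fromℕ< _ ⟩
  suc (toℕ i) % suc ℓ  ≡⟨ cong (λ j → suc j % suc ℓ) i≡ℓ ⟩
  suc ℓ % suc ℓ        ≡⟨ n%n≡0 (suc ℓ) ⟩
  0                    ∎
  where open ≡-Reasoning

lookupOr-next : ∀ d (xs : List A) {ℓ} → length xs ≡ ℓ → (i : Fin (suc ℓ)) →
  lookupOr d (d ∷ xs) (toℕ (next i)) ≡ lookupOr d xs (toℕ i)
lookupOr-next d xs refl i with m≤n⇒m<n∨m≡n (toℕ≤pred[n] i)
... | inj₁ i<ℓ rewrite toℕ-next-< i i<ℓ = refl
... | inj₂ i≡ℓ rewrite toℕ-next-last i i≡ℓ | i≡ℓ = sym (lookupOr-length d xs)

lookupOr-Injective : ∀ d {xs : List A} {ℓ} → Unique xs → length xs ≡ suc ℓ →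
  Injective _≡_ _≡_ (λ (i : Fin (suc ℓ)) → lookupOr d xs (toℕ i))
lookupOr-Injective d xs! |xs|≡ {i} {j} eq =
  toℕ-injective (lookupOr-injective d xs! (bounded i) (bounded j) eq)
  where
  bounded : ∀ (i : Fin _) → toℕ i < _
  bounded i = subst (toℕ i <_) (sym |xs|≡) (toℕ<n i)

n<2^n : ∀ n → n < 2 ^ n
n<2^n zero = s≤s z≤n
n<2^n (suc n) = subst (_≤ 2 ^ suc n) (+-comm (suc n) 1)
  (+-mono-≤ (n<2^n n) (subst (1 ≤_) (sym (+-identityʳ (2 ^ n))) (m^n>0 2 n)))

2+r+2^r<2^[1+r]+2 : ∀ r → 2 + r + 2 ^ r < 2 ^ suc r + 2
2+r+2^r<2^[1+r]+2 r = subst₂ _≤_ (lhs r (2 ^ r)) (rhs (2 ^ r)) (+-monoˡ-≤ (2 + 2 ^ r) (n<2^n r))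
  where
  lhs : ∀ r a → suc r + (2 + a) ≡ suc (2 + r + a)
  lhs = solve-∀
  rhs : ∀ a → a + (2 + a) ≡ a + (a + 0) + 2
  rhs = solve-∀

1+2^[1+r]<2^[1+r]+2 : ∀ r → 1 + 2 ^ suc r < 2 ^ suc r + 2
1+2^[1+r]<2^[1+r]+2 r = subst (suc (2 ^ suc r) <_) (+-comm 2 (2 ^ suc r)) ≤-refl

bitStrings : ℕ → List (List Bool)
bitStrings zero = [ [] ]
bitStrings (suc t) = map (true ∷_) (bitStrings t) ++ map (false ∷_) (bitStrings t)

length-bitStrings : ∀ t → length (bitStrings t) ≡ 2 ^ t
length-bitStrings zero = refl
length-bitStrings (suc t) = begin
  length (map (true ∷_) (bitStrings t) ++ map (false ∷_) (bitStrings t))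
    ≡⟨ length-++ (map (true ∷_) (bitStrings t)) ⟩
  length (map (true ∷_) (bitStrings t)) + length (map (false ∷_) (bitStrings t))
    ≡⟨ cong₂ _+_ (length-map _ (bitStrings t)) (length-map _ (bitStrings t)) ⟩
  length (bitStrings t) + length (bitStrings t)
    ≡⟨ cong₂ _+_ (length-bitStrings t) (trans (length-bitStrings t) (sym (+-identityʳ _))) ⟩
  2 ^ suc t ∎
  where open ≡-Reasoning

∈-bitStrings : ∀ bs → bs ∈ bitStrings (length bs)
∈-bitStrings [] = here refl
∈-bitStrings (true ∷ bs) = ∈-++⁺ˡ (∈-map⁺ (true ∷_) (∈-bitStrings bs))
∈-bitStrings (false ∷ bs) = ∈-++⁺ʳ _ (∈-map⁺ (false ∷_) (∈-bitStrings bs))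

module _ (H : Hypergraph) where

  private
    V E : Set
    V = Fin (n H)
    E = Fin (m H)

  open import Data.List.Membership.DecPropositional (Fin._≟_ {n H}) using () renaming (_∈?_ to _∈ᵥ?_)
  open import Data.List.Membership.DecPropositional (Fin._≟_ {m H}) using () renaming (_∈?_ to _∈ₑ?_)

  _∈ₑ_ : V → E → Set
  u ∈ₑ e = u ∈ₛ edge H e

  EdgeWithin : E → List V → Set
  EdgeWithin e Xs = ∀ u → u ∈ₑ e → u ∈ Xs

  Escapes : E → List V → Set
  Escapes e Xs = ∃ λ u → u ∈ₑ e × u ∉ Xs

  trace : List V → E → List Bool
  trace T e = map (λ t → does (t ∈ₛ? edge H e)) T

  trace-∈ : ∀ {e f u} T → u ∈ T → trace T e ≡ trace T f → u ∈ₑ e → u ∈ₑ f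
  trace-∈ {e} {f} (t ∷ T) (here refl) eq u∈e with t ∈ₛ? edge H e | t ∈ₛ? edge H f | eq
  ... | yes _   | yes u∈f | _  = u∈f
  ... | yes _   | no _    | ()
  ... | no u∉e  | _       | _  = contradiction u∈e u∉e
  trace-∈ (t ∷ T) (there u∈T) eq = trace-∈ T u∈T (∷-injectiveʳ eq)

  trace-injective : ∀ {x e f T} → x ∈ₑ e → x ∈ₑ f → EdgeWithin e (x ∷ T) → EdgeWithin f (x ∷ T) →
    trace T e ≡ trace T f → e ≡ f
  trace-injective {x} {T = T} x∈e x∈f e⊆ f⊆ eq =
    simple H (⊆-antisym (⊆-edge x∈f e⊆ eq) (⊆-edge x∈e f⊆ (sym eq)))
    where
    ⊆-edge : ∀ {e f} → x ∈ₑ f → EdgeWithin e (x ∷ T) → trace T e ≡ trace T f → edge H e ⊆ₛ edge H f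
    ⊆-edge x∈f e⊆ eq {u} u∈e with e⊆ u u∈e
    ... | here refl = x∈f
    ... | there u∈T = trace-∈ T u∈T eq u∈e

  Confined : V → List E → List V → Set
  Confined x Z T = ∀ e → x ∈ₑ e → e ∈ Z ⊎ EdgeWithin e (x ∷ T)

  code : ∀ Z T e → Dec (e ∈ Z) → E ⊎ List Bool
  code Z T e (yes _) = inj₁ e
  code Z T e (no _)  = inj₂ (trace T e)

  codes : List E → List V → List (E ⊎ List Bool)
  codes Z T = map inj₁ Z ++ map inj₂ (bitStrings (length T))

  code-∈ : ∀ Z T e d → code Z T e d ∈ codes Z T
  code-∈ Z T e (yes e∈Z) = ∈-++⁺ˡ (∈-map⁺ inj₁ e∈Z)
  code-∈ Z T e (no _) = ∈-++⁺ʳ _ (∈-map⁺ inj₂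
    (subst (λ t → trace T e ∈ bitStrings t) (length-map _ T) (∈-bitStrings (trace T e))))

  code-injective : ∀ {x Z T e f} → Confined x Z T → x ∈ₑ e → x ∈ₑ f →
    ∀ d d′ → code Z T e d ≡ code Z T f d′ → e ≡ f
  code-injective _ _ _ (yes _) (yes _) refl = refl
  code-injective {x} {Z} {T} confined x∈e x∈f (no e∉Z) (no f∉Z) eq =
    trace-injective x∈e x∈f (within x∈e e∉Z) (within x∈f f∉Z) (inj₂-injective eq)
    where
    within : ∀ {e} → x ∈ₑ e → e ∉ Z → EdgeWithin e (x ∷ T)
    within {e} x∈e e∉Z = Sum.[ (λ e∈Z → contradiction e∈Z e∉Z) , (λ e⊆ → e⊆) ]′ (confined e x∈e)

  length-codes : ∀ Z T → length (codes Z T) ≡ length Z + 2 ^ length T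
  length-codes Z T = begin
    length (codes Z T)
      ≡⟨ length-++ (map inj₁ Z) ⟩
    length (map inj₁ Z) + length (map inj₂ (bitStrings (length T)))
      ≡⟨ cong₂ _+_ (length-map inj₁ Z) (length-map inj₂ (bitStrings (length T))) ⟩
    length Z + length (bitStrings (length T))
      ≡⟨ cong (length Z +_) (length-bitStrings (length T)) ⟩
    length Z + 2 ^ length T ∎
    where open ≡-Reasoning

  degree≤ : ∀ {x Z T} → Confined x Z T → degree H x ≤ length Z + 2 ^ length T
  degree≤ {x} {Z} {T} confined = begin
    degree H x                  ≡⟨ length-map encode incident ⟨
    length (map encode incident) ≤⟨ Unique⇒length≤ (Unique-map⁺ injective incident-unique) codes-⊆ ⟩
    length (codes Z T)          ≡⟨ length-codes Z T ⟩
    length Z + 2 ^ length T     ∎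
    where
    open ≤-Reasoning
    incident : List E
    incident = filter (λ e → x ∈ₛ? edge H e) (allFin (m H))

    incident-unique : Unique incident
    incident-unique = filter⁺ (λ e → x ∈ₛ? edge H e) (allFin⁺ (m H))

    incident-∈ : ∀ {e} → e ∈ incident → x ∈ₑ e
    incident-∈ = proj₂ ∘ ∈-filter⁻ (λ e → x ∈ₛ? edge H e) {xs = allFin (m H)}

    encode : E → E ⊎ List Bool
    encode e = code Z T e (e ∈ₑ? Z)

    injective : ∀ {e f} → e ∈ incident → f ∈ incident → encode e ≡ encode f → e ≡ f
    injective {e} {f} e∈ f∈ = code-injective confined (incident-∈ e∈) (incident-∈ f∈) (e ∈ₑ? Z) (f ∈ₑ? Z)

    codes-⊆ : map encode incident ⊆ codes Z T
    codes-⊆ c∈ with ∈-map⁻ encode c∈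
    ... | e , _ , refl = code-∈ Z T e (e ∈ₑ? Z)

  escapes? : ∀ e Xs → Dec (Escapes e Xs)
  escapes? e Xs = Fin.any? λ u → (u ∈ₛ? edge H e) ×-dec ¬? (u ∈ᵥ? Xs)

  escapingEdge : ∀ x Z T → length Z + 2 ^ length T < degree H x →
    ∃ λ e → x ∈ₑ e × e ∉ Z × Escapes e (x ∷ T)
  escapingEdge x Z T few<deg
    with Fin.any? (λ e → (x ∈ₛ? edge H e) ×-dec ¬? (e ∈ₑ? Z) ×-dec escapes? e (x ∷ T))
  ... | yes found = found
  ... | no none = contradiction (degree≤ confined) (<⇒≱ few<deg)
    where
    confined : Confined x Z T
    confined e x∈e with e ∈ₑ? Z
    ... | yes e∈Z = inj₁ e∈Z
    ... | no e∉Z = inj₂ λ u u∈e →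
      decidable-stable (u ∈ᵥ? x ∷ T) λ u∉ → none (e , x∈e , e∉Z , u , u∈e , u∉)

  -- A walk x e₁ v₁ … e_t v_t is stored as x and the steps (e₁ , v₁) ∷ … ∷ (e_t , v_t); paths are
  -- extended at x, the free end.
  Step : Set
  Step = E × V

  Walk : V → List Step → Set
  Walk x [] = ⊤
  Walk x ((e , y) ∷ ps) = x ∈ₑ e × y ∈ₑ e × Walk y ps

  end : V → List Step → V
  end x [] = x
  end x ((_ , y) ∷ ps) = end y ps

  targets : List Step → List V
  targets = map proj₂

  edges : List Step → List E
  edges = map proj₁

  vertices : V → List Step → List V
  vertices x ps = x ∷ targets ps

  vertices-++ : ∀ x A B → vertices x (A ++ B) ≡ vertices x A ++ targets B
  vertices-++ x A B = cong (x ∷_) (map-++ proj₂ A B)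

  end-++ : ∀ x A B → end x (A ++ B) ≡ end (end x A) B
  end-++ x [] B = refl
  end-++ x ((e , y) ∷ A) B = end-++ y A B

  Walk-++⁻ˡ : ∀ x A B → Walk x (A ++ B) → Walk x A
  Walk-++⁻ˡ x [] B _ = tt
  Walk-++⁻ˡ x ((e , y) ∷ A) B (x∈e , y∈e , w) = x∈e , y∈e , Walk-++⁻ˡ y A B w

  Walk-++⁻ʳ : ∀ x A B → Walk x (A ++ B) → Walk (end x A) B
  Walk-++⁻ʳ x [] B w = w
  Walk-++⁻ʳ x ((e , y) ∷ A) B (_ , _ , w) = Walk-++⁻ʳ y A B w

  Walk-++⁺ : ∀ x A B → Walk x A → Walk (end x A) B → Walk x (A ++ B)
  Walk-++⁺ x [] B _ w = w
  Walk-++⁺ x ((e , y) ∷ A) B (x∈e , y∈e , w) w′ = x∈e , y∈e , Walk-++⁺ y A B w w′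

  Walk-lookup : ∀ {x} ps {i} d d′ → Walk x ps → i < length ps →
    lookupOr d (vertices x ps) i ∈ₑ lookupOr d′ (edges ps) i ×
    lookupOr d (targets ps) i ∈ₑ lookupOr d′ (edges ps) i
  Walk-lookup ((e , y) ∷ ps) {zero} d d′ (x∈e , y∈e , _) _ = x∈e , y∈e
  Walk-lookup ((e , y) ∷ ps) {suc i} d d′ (_ , _ , w) (s≤s i<) = Walk-lookup ps d d′ w i<

  reverseSteps : V → List Step → List Step
  reverseSteps x [] = []
  reverseSteps x ((e , y) ∷ ps) = reverseSteps y ps ++ [ (e , x) ]

  end-reverseSteps : ∀ x A → end (end x A) (reverseSteps x A) ≡ x
  end-reverseSteps x [] = refl
  end-reverseSteps x ((e , y) ∷ A) = end-++ (end y A) (reverseSteps y A) [ (e , x) ]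

  Walk-reverseSteps : ∀ x A → Walk x A → Walk (end x A) (reverseSteps x A)
  Walk-reverseSteps x [] _ = tt
  Walk-reverseSteps x ((e , y) ∷ A) (x∈e , y∈e , w) =
    Walk-++⁺ (end y A) (reverseSteps y A) [ (e , x) ] (Walk-reverseSteps y A w)
      (subst (λ z → Walk z [ (e , x) ]) (sym (end-reverseSteps y A)) (y∈e , x∈e , tt))

  vertices-reverseSteps : ∀ x A → vertices (end x A) (reverseSteps x A) ≡ reverse (vertices x A)
  vertices-reverseSteps x [] = refl
  vertices-reverseSteps x ((e , y) ∷ A) = begin
    vertices (end y A) (reverseSteps y A ++ [ (e , x) ]) ≡⟨ vertices-++ (end y A) (reverseSteps y A) _ ⟩
    vertices (end y A) (reverseSteps y A) ++ [ x ]       ≡⟨ cong (_++ [ x ]) (vertices-reverseSteps y A) ⟩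
    reverse (vertices y A) ++ [ x ]                      ≡⟨ unfold-reverse x (vertices y A) ⟨
    reverse (x ∷ vertices y A)                           ∎
    where open ≡-Reasoning

  edges-reverseSteps : ∀ x A → edges (reverseSteps x A) ≡ reverse (edges A)
  edges-reverseSteps x [] = refl
  edges-reverseSteps x ((e , y) ∷ A) = begin
    edges (reverseSteps y A ++ [ (e , x) ]) ≡⟨ map-++ proj₁ (reverseSteps y A) _ ⟩
    edges (reverseSteps y A) ++ [ e ]       ≡⟨ cong (_++ [ e ]) (edges-reverseSteps y A) ⟩
    reverse (edges A) ++ [ e ]              ≡⟨ unfold-reverse e (edges A) ⟨
    reverse (e ∷ edges A)                   ∎
    where open ≡-Reasoning

  length-reverseSteps : ∀ x A → length (reverseSteps x A) ≡ length A
  length-reverseSteps x A = begin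
    length (reverseSteps x A)         ≡⟨ length-map proj₁ (reverseSteps x A) ⟨
    length (edges (reverseSteps x A)) ≡⟨ cong length (edges-reverseSteps x A) ⟩
    length (reverse (edges A))        ≡⟨ length-reverse (edges A) ⟩
    length (edges A)                  ≡⟨ length-map proj₁ A ⟩
    length A                          ∎
    where open ≡-Reasoning

  vertices-rotate : ∀ x A {s B} →
    vertices (end x A) (reverseSteps x A ++ s ∷ B) ≡ reverse (vertices x A) ++ targets (s ∷ B)
  vertices-rotate x A =
    trans (vertices-++ (end x A) (reverseSteps x A) _) (cong (_++ _) (vertices-reverseSteps x A))

  length-rotate : ∀ x A {s s′ B} → length (reverseSteps x A ++ s′ ∷ B) ≡ length (A ++ s ∷ B)
  length-rotate x A {s} {s′} {B} = begin
    length (reverseSteps x A ++ s′ ∷ B)       ≡⟨ length-++ (reverseSteps x A) ⟩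
    length (reverseSteps x A) + suc (length B) ≡⟨ cong (_+ suc (length B)) (length-reverseSteps x A) ⟩
    length A + suc (length B)                 ≡⟨ length-++ A ⟨
    length (A ++ s ∷ B)                       ∎
    where open ≡-Reasoning

  ∈-edges-++⁺ˡ : ∀ {e} A {B} → e ∈ edges A → e ∈ edges (A ++ B)
  ∈-edges-++⁺ˡ A {B} e∈A = subst (_ ∈_) (sym (map-++ proj₁ A B)) (∈-++⁺ˡ e∈A)

  record IsPath (x : V) (ps : List Step) : Set where
    field
      walk            : Walk x ps
      vertices-unique : Unique (vertices x ps)
      edges-unique    : Unique (edges ps)

  open IsPath

  trivialPath : ∀ x → IsPath x []
  trivialPath x = record { walk = tt ; vertices-unique = [] ∷ [] ; edges-unique = [] }

  extend : ∀ {x ps u f} → IsPath x ps → u ∉ vertices x ps → f ∉ edges ps → u ∈ₑ f → x ∈ₑ f →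
    IsPath u ((f , x) ∷ ps)
  extend P u∉ f∉ u∈f x∈f = record
    { walk            = u∈f , x∈f , walk P
    ; vertices-unique = Unique-∷ u∉ (vertices-unique P)
    ; edges-unique    = Unique-∷ f∉ (edges-unique P)
    }

  IsPath-++⁻ˡ : ∀ {x} A {B} → IsPath x (A ++ B) → IsPath x A
  IsPath-++⁻ˡ {x} A {B} P = record
    { walk            = Walk-++⁻ˡ x A B (walk P)
    ; vertices-unique = Unique-++⁻ˡ (vertices x A) (subst Unique (vertices-++ x A B) (vertices-unique P))
    ; edges-unique    = Unique-++⁻ˡ (edges A) (subst Unique (map-++ proj₁ A B) (edges-unique P))
    }

  IsPath⇒length< : ∀ {x ps} → IsPath x ps → length ps < n H
  IsPath⇒length< {x} {ps} P = begin
    suc (length ps)            ≡⟨ cong suc (length-map proj₂ ps) ⟨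
    length (vertices x ps)     ≤⟨ Unique⇒length≤ (vertices-unique P) (λ {u} _ → ∈-allFin u) ⟩
    length (allFin (n H))      ≡⟨ length-tabulate (λ u → u) ⟩
    n H                        ∎
    where open ≤-Reasoning

  closedPath⇒BergeCycle : ∀ {x C c} → IsPath x C → c ∉ edges C → x ∈ₑ c → end x C ∈ₑ c →
    BergeCycle H (length C)
  closedPath⇒BergeCycle {x} {C} {c} P c∉C x∈c end∈c = record
    { vs     = vs
    ; es     = es
    ; vs-inj = lookupOr-Injective x (vertices-unique P) (cong suc (length-map proj₂ C))
    ; es-inj = lookupOr-Injective c closed-edges-unique closed-edges-length
    ; here   = λ i → subst (_∈ₑ es i) (vertex-at i) (proj₁ (step-at i))
    ; there  = λ i → subst (_∈ₑ es i) (next-vertex-at i) (proj₂ (step-at i))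
    }
    where
    closed : List Step
    closed = C ++ [ (c , x) ]

    vs : Fin (suc (length C)) → V
    vs i = lookupOr x (vertices x C) (toℕ i)

    es : Fin (suc (length C)) → E
    es i = lookupOr c (edges closed) (toℕ i)

    closed-edges-unique : Unique (edges closed)
    closed-edges-unique = subst Unique (sym (map-++ proj₁ C _))
      (Unique-resp-↭ (∷↭∷ʳ c (edges C)) (Unique-∷ c∉C (edges-unique P)))

    closed-edges-length : length (edges closed) ≡ suc (length C)
    closed-edges-length = trans (length-map proj₁ closed) (trans (length-++ C) (+-comm (length C) 1))

    step-at : ∀ i → lookupOr x (vertices x closed) (toℕ i) ∈ₑ es i ×
                    lookupOr x (targets closed) (toℕ i) ∈ₑ es i
    step-at i = Walk-lookup closed x c (Walk-++⁺ x C _ (walk P) (end∈c , x∈c , tt))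
      (subst (toℕ i <_) (trans (sym closed-edges-length) (length-map proj₁ closed)) (toℕ<n i))

    vertex-at : ∀ i → lookupOr x (vertices x closed) (toℕ i) ≡ vs i
    vertex-at i = trans (cong (λ vs → lookupOr x vs (toℕ i)) (vertices-++ x C _))
                        (lookupOr-∷ʳ x (vertices x C) (toℕ i))

    -- Index length C lies beyond targets C and yields the default x = vs 0: this is where next wraps.
    next-vertex-at : ∀ i → lookupOr x (targets closed) (toℕ i) ≡ vs (next i)
    next-vertex-at i = begin
      lookupOr x (targets closed) (toℕ i)      ≡⟨ cong (λ ts → lookupOr x ts (toℕ i)) (map-++ proj₂ C _) ⟩
      lookupOr x (targets C ++ [ x ]) (toℕ i)  ≡⟨ lookupOr-∷ʳ x (targets C) (toℕ i) ⟩
      lookupOr x (targets C) (toℕ i)           ≡⟨ lookupOr-next x (targets C) (length-map proj₂ C) i ⟨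
      vs (next i)                              ∎
      where open ≡-Reasoning

  rotate : ∀ {x} A {g w B i} → IsPath x (A ++ (g , w) ∷ B) → i ∉ edges (A ++ (g , w) ∷ B) →
    x ∈ₑ i → w ∈ₑ i →
    IsPath (end x A) (reverseSteps x A ++ (i , w) ∷ B) × g ∉ edges (reverseSteps x A ++ (i , w) ∷ B)
  rotate {x} A {g} {w} {B} {i} P i∉ x∈i w∈i = rotated , proj₂ exchanged ∘ subst (g ∈_) edges-rotated
    where
    edges-rotated : edges (reverseSteps x A ++ (i , w) ∷ B) ≡ reverse (edges A) ++ i ∷ edges B
    edges-rotated = trans (map-++ proj₁ (reverseSteps x A) _) (cong (_++ _) (edges-reverseSteps x A))

    exchanged : Unique (reverse (edges A) ++ i ∷ edges B) × g ∉ reverse (edges A) ++ i ∷ edges B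
    exchanged = exchange (edges A) (subst Unique (map-++ proj₁ A _) (edges-unique P))
                  (i∉ ∘ subst (i ∈_) (sym (map-++ proj₁ A _)))

    B-walk : Walk w B
    B-walk = proj₂ (proj₂ (Walk-++⁻ʳ x A _ (walk P)))

    rotated : IsPath (end x A) (reverseSteps x A ++ (i , w) ∷ B)
    rotated = record
      { walk = Walk-++⁺ (end x A) (reverseSteps x A) _
                 (Walk-reverseSteps x A (Walk-++⁻ˡ x A _ (walk P)))
                 (subst (λ z → Walk z ((i , w) ∷ B)) (sym (end-reverseSteps x A)) (x∈i , w∈i , B-walk))
      ; vertices-unique = subst Unique (sym (vertices-rotate x A))
          (Unique-resp-↭ (↭-sym (++⁺ʳ _ (↭-reverse (vertices x A))))
            (subst Unique (vertices-++ x A _) (vertices-unique P)))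
      ; edges-unique = subst Unique (sym edges-rotated) (proj₁ exchanged)
      }

  module _ (r : ℕ) (deg : MinDegreeAtLeast H (2 ^ suc r + 2)) where

    LongCycle : Set
    LongCycle = HasBergeCycleOfLengthAtLeast H (3 + r)

    Progress : ℕ → Set
    Progress ℓ = LongCycle ⊎ ∃₂ λ y qs → IsPath y qs × ℓ < length qs

    initial : V → List Step → List V
    initial x ps = take (2 + r) (vertices x ps)

    EarlyEscape : V → List Step → Step → Set
    EarlyEscape x ps (e , _) = Escapes e (initial x ps)

    earlyEscape? : ∀ x ps s → Dec (EarlyEscape x ps s)
    earlyEscape? x ps (e , _) = escapes? e (initial x ps)

    <degree : ∀ {x z t} a b → z ≤ a → t ≤ b → a + 2 ^ b < 2 ^ suc r + 2 → z + 2 ^ t < degree H x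
    <degree {x} a b z≤a t≤b lt = <-≤-trans (≤-<-trans (+-mono-≤ z≤a (^-monoʳ-≤ 2 t≤b)) lt) (deg x)

    closeCycle : ∀ {x} A {B c} → IsPath x (A ++ B) → c ∉ edges A → x ∈ₑ c → end x A ∈ₑ c →
      2 + r ≤ length A → LongCycle
    closeCycle A P c∉ x∈c end∈c long =
      length A , s≤s long , closedPath⇒BergeCycle (IsPath-++⁻ˡ A P) c∉ x∈c end∈c

    pathEdge⇒cycle : ∀ {x} A {e y B} → IsPath x (A ++ (e , y) ∷ B) → x ∈ₑ e → 2 + r ≤ length A → LongCycle
    pathEdge⇒cycle {x} A {e} P x∈e long = closeCycle A P e∉A x∈e (proj₁ (Walk-++⁻ʳ x A _ (walk P))) long
      where
      e∉A : e ∉ edges A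
      e∉A = ∉-middle (edges A) (subst Unique (map-++ proj₁ A _) (edges-unique P)) ∘ ∈-++⁺ˡ

    offPathEdge⇒cycle : ∀ {x} A {e y B f} → IsPath x (A ++ (e , y) ∷ B) → f ∉ edges (A ++ (e , y) ∷ B) →
      x ∈ₑ f → y ∈ₑ f → 1 + r ≤ length A → LongCycle
    offPathEdge⇒cycle {x} A {e} {y} {B} {f} P f∉ x∈f y∈f long =
      closeCycle (A ++ [ (e , y) ]) (subst (IsPath x) (sym A′++B) P) f∉A′ x∈f
        (subst (_∈ₑ f) (sym (end-++ x A _)) y∈f)
        (subst (2 + r ≤_) (sym (trans (length-++ A) (+-comm (length A) 1))) (s≤s long))
      where
      A′++B : (A ++ [ (e , y) ]) ++ B ≡ A ++ (e , y) ∷ B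
      A′++B = ++-assoc A [ (e , y) ] B
      f∉A′ : f ∉ edges (A ++ [ (e , y) ])
      f∉A′ = f∉ ∘ subst (λ ps → f ∈ edges ps) A′++B ∘ ∈-edges-++⁺ˡ (A ++ [ (e , y) ])

    offPathEdge⇒progress : ∀ {x ps f u} → IsPath x ps → f ∉ edges ps → x ∈ₑ f → u ∈ₑ f → u ∉ initial x ps →
      Progress (length ps)
    offPathEdge⇒progress {x} {ps} {f} {u} P f∉ x∈f u∈f u∉S with u ∈ᵥ? vertices x ps
    ... | no u∉ = inj₂ (u , (f , x) ∷ ps , extend P u∉ f∉ u∈f x∈f , ≤-refl)
    ... | yes (here refl) = contradiction (here refl) u∉S
    ... | yes (there u∈) with ∈-map-split proj₂ ps u∈
    ...   | A , _ , _ , refl , refl =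
      inj₁ (offPathEdge⇒cycle A P f∉ x∈f u∈f (∉-take-map⇒≤ proj₂ (1 + r) A (u∉S ∘ there)))

    latePathEdge⇒cycle : ∀ {x ps e} → IsPath x ps → x ∈ₑ e → e ∈ edges ps → e ∉ take (2 + r) (edges ps) →
      LongCycle
    latePathEdge⇒cycle {ps = ps} P x∈e e∈ e∉ with ∈-map-split proj₁ ps e∈
    ... | A , _ , _ , refl , refl = pathEdge⇒cycle A P x∈e (∉-take-map⇒≤ proj₁ (2 + r) A e∉)

    initial-rotate : ∀ x A {g w B i} → length A < 1 + r →
      initial (end x A) (reverseSteps x A ++ (i , w) ∷ B) ⊆ initial x (A ++ (g , w) ∷ B)
    initial-rotate x A {g} {w} {B} {i} A< {u} u∈ =
      subst (λ vs → u ∈ take (2 + r) vs) (sym (vertices-++ x A ((g , w) ∷ B)))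
        (∈-resp-↭ (take-reverse-++ (2 + r) (vertices x A) |vertices|≤)
          (subst (λ vs → u ∈ take (2 + r) vs) (vertices-rotate x A) u∈))
      where
      |vertices|≤ : length (vertices x A) ≤ 2 + r
      |vertices|≤ = s≤s (subst (_≤ 1 + r) (sym (length-map proj₂ A)) (<⇒≤ A<))

    rotation⇒progress : ∀ {x} A {g w B i} → IsPath x (A ++ (g , w) ∷ B) → length A < 1 + r →
      Escapes g (initial x (A ++ (g , w) ∷ B)) → i ∉ edges (A ++ (g , w) ∷ B) → x ∈ₑ i → w ∈ₑ i →
      Progress (length (A ++ (g , w) ∷ B))
    rotation⇒progress {x} A P A< (u , u∈g , u∉S) i∉ x∈i w∈i with rotate A P i∉ x∈i w∈i
    ... | P′ , g∉ = subst Progress (length-rotate x A)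
      (offPathEdge⇒progress P′ g∉ (proj₁ (Walk-++⁻ʳ x A _ (walk P))) u∈g (u∉S ∘ initial-rotate x A A<))

    earlyEscape⇒progress : ∀ {x} A {g w B} → IsPath x (A ++ (g , w) ∷ B) → length A < 1 + r →
      EarlyEscape x (A ++ (g , w) ∷ B) (g , w) → Progress (length (A ++ (g , w) ∷ B))
    earlyEscape⇒progress {x} A {g} {w} {B} P A< g-escapes =
      viaEscapingEdge (escapingEdge x early T′ (<degree (2 + r) r
        (length-take≤ (2 + r) (edges ps)) |T′|≤r (2+r+2^r<2^[1+r]+2 r)))
      where
      ps : List Step
      ps = A ++ (g , w) ∷ B
      early : List E
      early = take (2 + r) (edges ps)
      -- Dropping w lets 2 ^ |T′| absorb the k − 1 early edges; the price is the rotation case u = w.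
      T T′ : List V
      T = take (1 + r) (targets ps)
      T′ = filter (λ t → ¬? (t Fin.≟ w)) T

      |T′|≤r : length T′ ≤ r
      |T′|≤r = ≤-pred (≤-trans (filter-notAll _ T (Any.map (λ w≡t w≢t → w≢t (sym w≡t)) w∈T))
                               (length-take≤ (1 + r) (targets ps)))
        where
        w∈T : w ∈ T
        w∈T = ∈-take-map proj₂ (1 + r) A A<

      viaEscapingEdge : (∃ λ i → x ∈ₑ i × i ∉ early × Escapes i (x ∷ T′)) → Progress (length ps)
      viaEscapingEdge (i , x∈i , i∉early , u , u∈i , u∉) with i ∈ₑ? edges ps
      ... | yes i∈ = inj₁ (latePathEdge⇒cycle P x∈i i∈ i∉early)
      ... | no i∉ with u ∈ᵥ? initial x ps
      ...   | no u∉S = offPathEdge⇒progress P i∉ x∈i u∈i u∉S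
      ...   | yes (here refl) = contradiction (here refl) u∉
      ...   | yes (there u∈T) with u Fin.≟ w
      ...     | no u≢w = contradiction (there (∈-filter⁺ _ u∈T u≢w)) u∉
      ...     | yes refl = rotation⇒progress A P A< g-escapes i∉ x∈i u∈i

    ¬earlyEscape⇒progress : ∀ {x ps} → IsPath x ps → ¬ Any (EarlyEscape x ps) (take (1 + r) ps) →
      Progress (length ps)
    ¬earlyEscape⇒progress {x} {ps} P none =
      viaEscapingEdge (escapingEdge x next-edge T (<degree 1 (1 + r)
        (length-take≤ 1 (drop (1 + r) (edges ps))) (length-take≤ (1 + r) (targets ps))
        (1+2^[1+r]<2^[1+r]+2 r)))
      where
      -- e_{k−1} closes only a cycle of length k − 1.
      next-edge : List E
      next-edge = take 1 (drop (1 + r) (edges ps))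
      T : List V
      T = take (1 + r) (targets ps)

      viaEscapingEdge : (∃ λ e → x ∈ₑ e × e ∉ next-edge × Escapes e (x ∷ T)) → Progress (length ps)
      viaEscapingEdge (e , x∈e , e∉next , esc@(u , u∈e , u∉S)) with e ∈ₑ? edges ps
      ... | no e∉ = offPathEdge⇒progress P e∉ x∈e u∈e u∉S
      ... | yes e∈ with e ∈ₑ? take (1 + r) (edges ps)
      ...   | yes e∈early = contradiction
                (Any.map (λ { refl → esc }) (Any.map⁻ (subst (e ∈_) (take-map (1 + r) ps) e∈early))) none
      ...   | no e∉early =
        inj₁ (latePathEdge⇒cycle P x∈e e∈ (Sum.[ e∉early , e∉next ] ∘ ∈-take-suc (1 + r) (edges ps)))

    progress : ∀ {x ps} → IsPath x ps → Progress (length ps)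
    progress {x} {ps} P with Any.any? (earlyEscape? x ps) (take (1 + r) ps)
    ... | no none = ¬earlyEscape⇒progress P none
    ... | yes some with find some
    ...   | _ , s∈ , escape with ∈-take-split (1 + r) ps s∈
    ...     | A , _ , refl , A< = earlyEscape⇒progress A P A< escape

    search : ∀ {x ps} fuel → IsPath x ps → n H ≤ length ps + fuel → LongCycle
    search zero P n≤ = contradiction (subst (n H ≤_) (+-identityʳ _) n≤) (<⇒≱ (IsPath⇒length< P))
    search {ps = ps} (suc fuel) P n≤ with progress P
    ... | inj₁ cycle = cycle
    ... | inj₂ (_ , qs , Q , longer) = search fuel Q (begin
      n H                      ≤⟨ n≤ ⟩
      length ps + suc fuel     ≡⟨ +-suc (length ps) fuel ⟩
      suc (length ps) + fuel   ≤⟨ +-monoˡ-≤ fuel longer ⟩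
      length qs + fuel         ∎)
      where open ≤-Reasoning

theorem2p3 : (k : ℕ) → 3 ≤ k → (H : Hypergraph) → 1 ≤ n H →
    MinDegreeAtLeast H (2 ^ (k ∸ 2) + 2) →
    HasBergeCycleOfLengthAtLeast H k
theorem2p3 (suc (suc (suc r))) _ H 1≤n deg = search H r deg (n H) (trivialPath H (fromℕ< 1≤n)) ≤-refl
theorem2p3 (suc (suc zero)) (s≤s (s≤s ())) _ _ _
theorem2p3 (suc zero) (s≤s ()) _ _ _
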